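{- Let $\mathcal{M}$ be a molecule such that there is a derivation $\pi$ of $\mathcal{M}$ in the sequent calculus $\mathrm{ISC}$. Then there is a derivation $\mathrm{clean}(\pi)$ of the same molecule $\mathcal{M}$ in $\mathrm{ISC}$ which contains no application of the rules (P) and (Fus).
   Context: Formulas are generated by $\sigma ::= a \mid \sigma\to\sigma \mid \sigma\wedge\sigma \mid \sigma\cap\sigma$, where $a$ ranges over a countable set of propositional variables ($\wedge$ is the "global" conjunction, $\cap$ the "local" conjunction/intersection). A context is a finite sequence of formulas. An atom $(\Gamma;\sigma)$ is a pair of a context and a formula. A molecule is a finite multiset of atoms all of whose contexts have the same length; we write $[(\Gamma_i;\sigma_i)\mid i\in I]$ or $[(\Gamma_i;\sigma_i)]_i$, and $\cup$ denotes multiset union. Commas in contexts denote concatenation. The system $\mathrm{ISC}$ derives molecules by the following rules (each rule: from the premise molecule(s) infer the conclusion molecule; in the "global" rules all molecules are indexed by the same finite set $I$): (Ax) $[(\alpha_i;\alpha_i)\mid i\in I]$ with no premise. (cut) from $[(\Gamma_i;\alpha_i)\mid i\in I]$ and $[(\Delta_i,\alpha_i;\beta_i)\mid i\in I]$ infer $[(\Gamma_i,\Delta_i;\beta_i)\mid i\in I]$. (W) from $[(\Gamma_i;\beta_i)]_i$ infer $[(\Gamma_i,\alpha_i;\beta_i)]_i$. (X) from $[(\Gamma_i,\beta_i,\alpha_i,\Delta_i;\gamma_i)]_i$ infer $[(\Gamma_i,\alpha_i,\beta_i,\Delta_i;\gamma_i)]_i$. (C) from $[(\Gamma_i,\alpha_i,\alpha_i;\beta_i)]_i$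 infer $[(\Gamma_i,\alpha_i;\beta_i)]_i$. (Fus) from $[(\Gamma;\beta)]\cup\mathcal{M}$ infer $[(\Gamma;\beta),(\Gamma;\beta)]\cup\mathcal{M}$. (P) from $\mathcal{M}\cup\mathcal{N}$ infer $\mathcal{M}$. ($\to$L) from $[(\Gamma_i;\alpha_i)]_i$ and $[(\Delta_i,\beta_i;\gamma_i)]_i$ infer $[(\Gamma_i,\Delta_i,\alpha_i\to\beta_i;\gamma_i)]_i$. ($\to$R) from $[(\Gamma_i,\alpha_i;\beta_i)]_i$ infer $[(\Gamma_i;\alpha_i\to\beta_i)]_i$. ($\wedge$L) from $[(\Gamma_i,\alpha^L_i,\alpha^R_i;\beta_i)]_i$ infer $[(\Gamma_i,\alpha^L_i\wedge\alpha^R_i;\beta_i)]_i$. ($\wedge$R) from $[(\Gamma_i;\alpha_i)]_i$ and $[(\Delta_i;\beta_i)]_i$ infer $[(\Gamma_i,\Delta_i;\alpha_i\wedge\beta_i)]_i$. ($\cap$L$_k$), $k\in\{L,R\}$: from $[(\Gamma,\alpha_k;\beta)]\cup\mathcal{M}$ infer $[(\Gamma,\alpha_L\cap\alpha_R;\beta)]\cup\mathcal{M}$. ($\cap$R) from $[(\Gamma;\alpha),(\Gamma;\beta)]\cup\mathcal{M}$ infer $[(\Gamma;\alpha\cap\beta)]\cup\mathcal{M}$. -}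

module Defs where

open import Data.Nat using (ℕ; suc; _+_)
open import Data.Fin using (Fin)
open import Data.Vec using (Vec; []; _∷_; _++_; _∷ʳ_)
open import Data.List using (List; tabulate) renaming (_∷_ to _∷ₗ_; _++_ to _++ₗ_)
open import Data.List.Relation.Binary.Permutation.Propositional using (_↭_)
open import Data.Product using (_×_; _,_)
open import Data.Unit using (⊤)
open import Data.Empty using (⊥)

infixr 30 _⇒_
infixr 35 _∧_ _∩_

data Formula : Set where
  var : ℕ → Formula
  _⇒_ : Formula → Formula → Formula
  _∧_ : Formula → Formula → Formula
  _∩_ : Formula → Formula → Formula

-- A context of length n (comma = concatenation _++_ / snoc _∷ʳ_).
Ctx : ℕ → Set
Ctx n = Vec Formula n

Atom : ℕ → Set
Atom n = Ctx n × Formula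

-- Multisets are represented by lists; list order is irrelevant
-- because derivability is closed under permutation (constructor `perm`).
Molecule : ℕ → Set
Molecule n = List (Atom n)

-- The molecule [ f i | i ∈ I ] for the finite index set I = Fin k.
⟦_⟧ : ∀ {k n} → (Fin k → Atom n) → Molecule n
⟦ f ⟧ = tabulate f

data ISC : (n : ℕ) → Molecule n → Set where
  perm : ∀ {n} {M N : Molecule n} → M ↭ N → ISC n M → ISC n N
  ax   : ∀ {k} (α : Fin k → Formula) →
         ISC 1 ⟦ (λ i → (α i ∷ [] , α i)) ⟧
  cut  : ∀ {k m l} (Γ : Fin k → Ctx m) (Δ : Fin k → Ctx l) (α β : Fin k → Formula) →
         ISC m ⟦ (λ i → (Γ i , α i)) ⟧ →
         ISC (suc l) ⟦ (λ i → (Δ i ∷ʳ α i , β i)) ⟧ →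
         ISC (m + l) ⟦ (λ i → (Γ i ++ Δ i , β i)) ⟧
  W    : ∀ {k m} (Γ : Fin k → Ctx m) (α β : Fin k → Formula) →
         ISC m ⟦ (λ i → (Γ i , β i)) ⟧ →
         ISC (suc m) ⟦ (λ i → (Γ i ∷ʳ α i , β i)) ⟧
  X    : ∀ {k p q} (Γ : Fin k → Ctx p) (Δ : Fin k → Ctx q) (α β γ : Fin k → Formula) →
         ISC (p + suc (suc q)) ⟦ (λ i → (Γ i ++ (β i ∷ α i ∷ Δ i) , γ i)) ⟧ →
         ISC (p + suc (suc q)) ⟦ (λ i → (Γ i ++ (α i ∷ β i ∷ Δ i) , γ i)) ⟧
  C    : ∀ {k m} (Γ : Fin k → Ctx m) (α β : Fin k → Formula) →
         ISC (suc (suc m)) ⟦ (λ i → (Γ i ∷ʳ α i ∷ʳ α i , β i)) ⟧ →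
         ISC (suc m) ⟦ (λ i → (Γ i ∷ʳ α i , β i)) ⟧
  Fus  : ∀ {n} (Γ : Ctx n) (β : Formula) (M : Molecule n) →
         ISC n ((Γ , β) ∷ₗ M) →
         ISC n ((Γ , β) ∷ₗ (Γ , β) ∷ₗ M)
  P    : ∀ {n} (M N : Molecule n) →
         ISC n (M ++ₗ N) →
         ISC n M
  ⇒L   : ∀ {k p q} (Γ : Fin k → Ctx p) (Δ : Fin k → Ctx q) (α β γ : Fin k → Formula) →
         ISC p ⟦ (λ i → (Γ i , α i)) ⟧ →
         ISC (suc q) ⟦ (λ i → (Δ i ∷ʳ β i , γ i)) ⟧ →
         ISC (suc (p + q)) ⟦ (λ i → ((Γ i ++ Δ i) ∷ʳ (α i ⇒ β i) , γ i)) ⟧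
  ⇒R   : ∀ {k m} (Γ : Fin k → Ctx m) (α β : Fin k → Formula) →
         ISC (suc m) ⟦ (λ i → (Γ i ∷ʳ α i , β i)) ⟧ →
         ISC m ⟦ (λ i → (Γ i , α i ⇒ β i)) ⟧
  ∧L   : ∀ {k m} (Γ : Fin k → Ctx m) (αL αR β : Fin k → Formula) →
         ISC (suc (suc m)) ⟦ (λ i → (Γ i ∷ʳ αL i ∷ʳ αR i , β i)) ⟧ →
         ISC (suc m) ⟦ (λ i → (Γ i ∷ʳ (αL i ∧ αR i) , β i)) ⟧
  ∧R   : ∀ {k p q} (Γ : Fin k → Ctx p) (Δ : Fin k → Ctx q) (α β : Fin k → Formula) →
         ISC p ⟦ (λ i → (Γ i , α i)) ⟧ →
         ISC q ⟦ (λ i → (Δ i , β i)) ⟧ →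
         ISC (p + q) ⟦ (λ i → (Γ i ++ Δ i , α i ∧ β i)) ⟧
  ∩L-L : ∀ {m} (Γ : Ctx m) (αL αR β : Formula) (M : Molecule (suc m)) →
         ISC (suc m) ((Γ ∷ʳ αL , β) ∷ₗ M) →
         ISC (suc m) ((Γ ∷ʳ (αL ∩ αR) , β) ∷ₗ M)
  ∩L-R : ∀ {m} (Γ : Ctx m) (αL αR β : Formula) (M : Molecule (suc m)) →
         ISC (suc m) ((Γ ∷ʳ αR , β) ∷ₗ M) →
         ISC (suc m) ((Γ ∷ʳ (αL ∩ αR) , β) ∷ₗ M)
  ∩R   : ∀ {n} (Γ : Ctx n) (α β : Formula) (M : Molecule n) →
         ISC n ((Γ , α) ∷ₗ (Γ , β) ∷ₗ M) →
         ISC n ((Γ , α ∩ β) ∷ₗ M)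

NoPFus : ∀ {n} {M : Molecule n} → ISC n M → Set
NoPFus (perm _ d)          = NoPFus d
NoPFus (ax _)              = ⊤
NoPFus (cut _ _ _ _ d e)   = NoPFus d × NoPFus e
NoPFus (W _ _ _ d)         = NoPFus d
NoPFus (X _ _ _ _ _ d)     = NoPFus d
NoPFus (C _ _ _ d)         = NoPFus d
NoPFus (Fus _ _ _ _)       = ⊥
NoPFus (P _ _ _)           = ⊥
NoPFus (⇒L _ _ _ _ _ d e)  = NoPFus d × NoPFus e
NoPFus (⇒R _ _ _ d)        = NoPFus d
NoPFus (∧L _ _ _ _ d)      = NoPFus d
NoPFus (∧R _ _ _ _ d e)    = NoPFus d × NoPFus e
NoPFus (∩L-L _ _ _ _ _ d)  = NoPFus d
NoPFus (∩L-R _ _ _ _ _ d)  = NoPFus d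
NoPFus (∩R _ _ _ _ d)      = NoPFus d

module Submission where

-- A derivation of M yields a clean derivation of every molecule N all of whose atoms
-- occur in M, with arbitrary multiplicities.  This stronger claim absorbs (P) and (Fus),
-- whose conclusions have no atoms beyond those of their premises.  It passes through a
-- global rule because such a rule may be restricted to any reindexing of its family, and
-- through a local rule acting on an atom c by applying the rule once for every copy of c
-- in N, each time to fresh copies of its premise atoms.

open import Defs
open import Data.Nat using (ℕ; zero; suc)
open import Data.Fin using (Fin)
open import Data.Product using (Σ; ∃; _×_; _,_; proj₁; proj₂)
open import Data.Sum using (inj₁; inj₂)
open import Data.Vec using (_∷ʳ_)
open import Data.List using (List; []; _∷_; _++_; [_]; length; lookup; tabulate; concat; replicate)
open import Data.List.Properties using (tabulate-cong; tabulate-lookup; ++-assoc)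
open import Data.List.Membership.Propositional.Properties using (∈-tabulate⁺; ∈-tabulate⁻; ∈-lookup; ∈-++⁻)
open import Data.List.Relation.Unary.Any using (here; there)
open import Data.List.Relation.Binary.Subset.Propositional using (_⊆_)
open import Data.List.Relation.Binary.Subset.Propositional.Properties
  using (⊆-refl; ⊆-trans; ⊆-reflexive-↭; ∈-∷⁺ʳ; xs⊆xs++ys; ++⁺)
open import Data.List.Relation.Binary.Permutation.Propositional using (_↭_; ↭-sym; ↭-refl; ↭-trans; prep)
open import Data.List.Relation.Binary.Permutation.Propositional.Properties using (shift; shifts)
open import Relation.Binary.PropositionalEquality using (_≡_; refl; sym; trans; subst)
open import Function using (_∘_)

private
  variable
    A : Set
    k n : ℕ

Clean : Molecule n → Set
Clean {n} M = Σ (ISC n M) NoPFus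

clean-perm : {M N : Molecule n} → M ↭ N → Clean M → Clean N
clean-perm p (d , c) = perm p d , c

tabulate-∘-⊆ : ∀ {k′} (f : Fin k → A) (sel : Fin k′ → Fin k) → tabulate (f ∘ sel) ⊆ tabulate f
tabulate-∘-⊆ f sel x∈ with i , refl ← ∈-tabulate⁻ x∈ = ∈-tabulate⁺ (sel i)

⊆-tabulate⇒reindexing : (f : Fin k → A) {xs : List A} → xs ⊆ tabulate f →
                         Σ (Fin (length xs) → Fin k) λ sel → tabulate (f ∘ sel) ≡ xs
⊆-tabulate⇒reindexing f {xs} xs⊆ =
  proj₁ ∘ index , trans (tabulate-cong (sym ∘ proj₂ ∘ index)) (tabulate-lookup xs)
  where index = λ j → ∈-tabulate⁻ (xs⊆ (∈-lookup {xs = xs} j))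

⊆∷⇒replicate++⊆ : ∀ {x : A} {xs ys} → ys ⊆ x ∷ xs →
                  ∃ λ r → ∃ λ zs → replicate r x ++ zs ↭ ys × zs ⊆ xs
⊆∷⇒replicate++⊆ {ys = []} _ = 0 , [] , ↭-refl , λ ()
⊆∷⇒replicate++⊆ {x = x} {ys = y ∷ ys} ys⊆ with ys⊆ (here refl) | ⊆∷⇒replicate++⊆ (ys⊆ ∘ there)
... | here refl | r , zs , p , zs⊆ = suc r , zs , prep x p , zs⊆
... | there y∈  | r , zs , p , zs⊆ =
  r , y ∷ zs , ↭-trans (shift y (replicate r x) zs) (prep y p) ,
  λ { (here refl) → y∈ ; (there z∈) → zs⊆ z∈ }

concat-replicate-⊆ : ∀ r {xs : List A} → concat (replicate r xs) ⊆ xs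
concat-replicate-⊆ zero ()
concat-replicate-⊆ (suc r) {xs} x∈ with ∈-++⁻ xs x∈
... | inj₁ x∈xs = x∈xs
... | inj₂ x∈rest = concat-replicate-⊆ r x∈rest

LocalRule : Molecule n → Molecule n → Set
LocalRule Ps Cs = ∀ S → Clean (Ps ++ S) → Clean (Cs ++ S)

LocalRule-++ : {Ps Cs Qs Ds : Molecule n} →
               LocalRule Ps Cs → LocalRule Qs Ds → LocalRule (Ps ++ Qs) (Cs ++ Ds)
LocalRule-++ {Ps = Ps} {Cs} {Qs} {Ds} rule₁ rule₂ S d =
  subst Clean (sym (++-assoc Cs Ds S)) (clean-perm (shifts Ds Cs)
    (rule₂ (Cs ++ S) (clean-perm (shifts Cs Qs)
      (rule₁ (Qs ++ S) (subst Clean (++-assoc Ps Qs S) d)))))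

LocalRule-replicate : {Ps : Molecule n} {c : Atom n} →
                      LocalRule Ps [ c ] → ∀ r → LocalRule (concat (replicate r Ps)) (replicate r c)
LocalRule-replicate rule zero    S d = d
LocalRule-replicate rule (suc r) = LocalRule-++ rule (LocalRule-replicate rule r)

clean-global : (f : Fin k → Atom n) →
               (∀ {k′} (sel : Fin k′ → Fin k) → Clean ⟦ f ∘ sel ⟧) →
               ∀ {N} → N ⊆ ⟦ f ⟧ → Clean N
clean-global f clean-sel N⊆ with sel , eq ← ⊆-tabulate⇒reindexing f N⊆ = subst Clean eq (clean-sel sel)

clean-local : ∀ (Ps : Molecule n) {c M} → LocalRule Ps [ c ] →
              (∀ {N} → N ⊆ Ps ++ M → Clean N) → ∀ {N} → N ⊆ c ∷ M → Clean N
clean-local Ps rule clean-below N⊆ with r , R , p , R⊆ ← ⊆∷⇒replicate++⊆ N⊆ =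
  clean-perm p (LocalRule-replicate rule r R (clean-below (++⁺ (concat-replicate-⊆ r) R⊆)))

clean-⊆ : {M N : Molecule n} → ISC n M → N ⊆ M → Clean N
clean-⊆ (perm p d) N⊆ = clean-⊆ d (⊆-trans N⊆ (⊆-reflexive-↭ (↭-sym p)))
clean-⊆ (Fus Γ β M d) N⊆ = clean-⊆ d (⊆-trans N⊆ (∈-∷⁺ʳ (here refl) ⊆-refl))
clean-⊆ (P M M′ d) N⊆ = clean-⊆ d (⊆-trans N⊆ (xs⊆xs++ys M M′))
clean-⊆ (ax α) = clean-global _ λ sel → ax (α ∘ sel) , _
clean-⊆ (cut Γ Δ α β d e) = clean-global _ λ sel →
  let d′ , c = clean-⊆ d (tabulate-∘-⊆ _ sel) ; e′ , c′ = clean-⊆ e (tabulate-∘-⊆ _ sel) in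
  cut (Γ ∘ sel) (Δ ∘ sel) (α ∘ sel) (β ∘ sel) d′ e′ , c , c′
clean-⊆ (W Γ α β d) = clean-global _ λ sel →
  let d′ , c = clean-⊆ d (tabulate-∘-⊆ _ sel) in W (Γ ∘ sel) (α ∘ sel) (β ∘ sel) d′ , c
clean-⊆ (X Γ Δ α β γ d) = clean-global _ λ sel →
  let d′ , c = clean-⊆ d (tabulate-∘-⊆ _ sel) in
  X (Γ ∘ sel) (Δ ∘ sel) (α ∘ sel) (β ∘ sel) (γ ∘ sel) d′ , c
clean-⊆ (C Γ α β d) = clean-global _ λ sel →
  let d′ , c = clean-⊆ d (tabulate-∘-⊆ _ sel) in C (Γ ∘ sel) (α ∘ sel) (β ∘ sel) d′ , c
clean-⊆ (⇒L Γ Δ α β γ d e) = clean-global _ λ sel →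
  let d′ , c = clean-⊆ d (tabulate-∘-⊆ _ sel) ; e′ , c′ = clean-⊆ e (tabulate-∘-⊆ _ sel) in
  ⇒L (Γ ∘ sel) (Δ ∘ sel) (α ∘ sel) (β ∘ sel) (γ ∘ sel) d′ e′ , c , c′
clean-⊆ (⇒R Γ α β d) = clean-global _ λ sel →
  let d′ , c = clean-⊆ d (tabulate-∘-⊆ _ sel) in ⇒R (Γ ∘ sel) (α ∘ sel) (β ∘ sel) d′ , c
clean-⊆ (∧L Γ αL αR β d) = clean-global _ λ sel →
  let d′ , c = clean-⊆ d (tabulate-∘-⊆ _ sel) in ∧L (Γ ∘ sel) (αL ∘ sel) (αR ∘ sel) (β ∘ sel) d′ , c
clean-⊆ (∧R Γ Δ α β d e) = clean-global _ λ sel →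
  let d′ , c = clean-⊆ d (tabulate-∘-⊆ _ sel) ; e′ , c′ = clean-⊆ e (tabulate-∘-⊆ _ sel) in
  ∧R (Γ ∘ sel) (Δ ∘ sel) (α ∘ sel) (β ∘ sel) d′ e′ , c , c′
clean-⊆ (∩L-L Γ αL αR β M d) =
  clean-local [ (Γ ∷ʳ αL , β) ] (λ { S (d′ , c) → ∩L-L Γ αL αR β S d′ , c }) (clean-⊆ d)
clean-⊆ (∩L-R Γ αL αR β M d) =
  clean-local [ (Γ ∷ʳ αR , β) ] (λ { S (d′ , c) → ∩L-R Γ αL αR β S d′ , c }) (clean-⊆ d)
clean-⊆ (∩R Γ α β M d) =
  clean-local ((Γ , α) ∷ [ (Γ , β) ]) (λ { S (d′ , c) → ∩R Γ α β S d′ , c }) (clean-⊆ d)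

lemma2p1 : ∀ {n} {M : Molecule n} (π : ISC n M) → Σ (ISC n M) NoPFus
lemma2p1 π = clean-⊆ π ⊆-refl
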